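{- For every set of formulas $\Gamma\cup\{A\}$ over $\Sigma$: $\Gamma\vdash_{LET_K^+}A$ if and only if $\Gamma\models_{Mat(LET_K^+)}A$.
   Context: Formulas are built from a denumerable set of propositional variables over $\Sigma=\{\land,\lor,\to,\neg,\circ\}$. The logic $LET_K$ is the natural deduction system with rules: ($\land$I) from $A,B$ infer $A\land B$; ($\land$E) from $A\land B$ infer $A$ and $B$; ($\lor$I) from $A$ (or from $B$) infer $A\lor B$; ($\lor$E) from $A\lor B$ and derivations of $C$ from $[A]$ and from $[B]$ infer $C$; ($\neg\land$I) from $\neg A$ (or $\neg B$) infer $\neg(A\land B)$; ($\neg\land$E) from $\neg(A\land B)$ and derivations of $C$ from $[\neg A]$ and from $[\neg B]$ infer $C$; ($\neg\lor$I) from $\neg A,\neg B$ infer $\neg(A\lor B)$; ($\neg\lor$E) from $\neg(A\lor B)$ infer $\neg A$ and $\neg B$; (DN) $A$ and $\neg\neg A$ are inter-derivable; ($\to$I) from a derivation of $B$ from $[A]$ infer $A\to B$; ($\to$E) from $A\to B$ and $A$ infer $B$; ($\to_{CL}$) axiom $A\lor(A\to B)$; ($\neg\to$I) from $A,\neg B$ infer $\neg(A\to B)$; ($\neg\to$E) from $\neg(A\to B)$ infer $A$ and $\neg B$; (EXP$^\circ$) from $\circ A,A,\neg A$ infer $B$; (PEM$^\circ$) from $\circ A$ infer $A\lor\neg A$ (bracketed hypotheses are discharged). Write $A^T$ for $\circ A\land A$, $A^F$ for $\circ A\land\neg A$. $LET_K^+$ adds: (I$\circ$) axiom $\circ\circ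 A$; (I$\neg\circ$) from $\circ A$ infer $\circ\neg A$; (E$\neg\circ$) from $\circ\neg A$ infer $\circ A$; (I$\land$T) from $A^T,B^T$ infer $(A\land B)^T$; (I$\land$F) from $A^F$ (or $B^F$) infer $(A\land B)^F$; (I$\lor$T) from $A^T$ (or $B^T$) infer $(A\lor B)^T$; (I$\lor$F) from $A^F,B^F$ infer $(A\lor B)^F$; (I$\to$T) from $A^F$ (or $B^T$) infer $(A\to B)^T$; (I$\to$F) from $A,B^F$ infer $(A\to B)^F$; (E$\land$T) from $(A\land B)^T$ infer $A^T$ and $B^T$; (E$\land$F) from $(A\land B)^F$ and derivations of $C$ from $[A^F]$ and from $[B^F]$ infer $C$; (E$\lor$T) from $(A\lor B)^T$ and derivations of $C$ from $[A^T]$ and from $[B^T]$ infer $C$; (E$\lor$F) from $(A\lor B)^F$ infer $A^F$ and $B^F$; (E$\to$T) from $(A\to B)^T$ and derivations of $C$ from $[A^F]$ and from $[B^T]$ infer $C$; (E$\to$F) from $(A\to B)^F$ infer $A$ and $B^F$. For a Boolean algebra $\mathcal{B}=\langle\mathbf{B},\sqcap,\sqcup,\Rightarrow,\sim,0,1\rangle$, the twist structure $\mathcal{T}_\mathcal{B}$ is the algebra over $\Sigma$ with domain $B^{\mathcal{B}}_{LET_K}=\{z\in\mathbf{B}^3: z_3\le z_1\sqcup z_2,\ z_1\sqcap z_2\sqcap z_3=0\}$ and operations $z\tilde\land w=(z_1\sqcap w_1,\ z_2\sqcup w_2,\ (z_1\sqcap z_3\sqcap w_1\sqcap w_3)\sqcup(z_2\sqcap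 z_3)\sqcup(w_2\sqcap w_3))$; $z\tilde\lor w=(z_1\sqcup w_1,\ z_2\sqcap w_2,\ (z_2\sqcap z_3\sqcap w_2\sqcap w_3)\sqcup(z_1\sqcap z_3)\sqcup(w_1\sqcap w_3))$; $z\tilde\to w=(z_1\Rightarrow w_1,\ z_1\sqcap w_2,\ (z_1\sqcap w_2\sqcap w_3)\sqcup(z_2\sqcap z_3)\sqcup(w_1\sqcap w_3))$; $\tilde\neg z=(z_2,z_1,z_3)$; $\tilde\circ z=(z_3,\sim z_3,1)$. It induces the logical matrix $\mathcal{M}(\mathcal{B})=\langle\mathcal{T}_\mathcal{B},\mathrm{D}_\mathcal{B}\rangle$ with $\mathrm{D}_\mathcal{B}=\{z: z_1=1\}$. $Mat(LET_K^+)$ is the class of all matrices $\mathcal{M}(\mathcal{B})$, $\mathcal{B}$ a Boolean algebra, and $\Gamma\models_{Mat(LET_K^+)}A$ iff for every such matrix and every homomorphism $v$ from the formula algebra into $\mathcal{T}_\mathcal{B}$, $v(B)\in\mathrm{D}_\mathcal{B}$ for all $B\in\Gamma$ implies $v(A)\in\mathrm{D}_\mathcal{B}$. -}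

module Defs where

open import Level using (Level; _⊔_) renaming (suc to lsuc)
open import Data.Nat using (ℕ)
open import Data.List using (List; _∷_; [])
open import Data.List.Membership.Propositional using (_∈_)
open import Data.Product using (Σ; _×_; _,_; proj₁)
open import Algebra.Lattice.Bundles using (BooleanAlgebra)

infixr 7 _∧ᶠ_
infixr 6 _∨ᶠ_
infixr 5 _⇒ᶠ_
infix  8 ¬ᶠ_ ∘ᶠ_

data Formula : Set where
  var   : ℕ → Formula
  _∧ᶠ_  : Formula → Formula → Formula
  _∨ᶠ_  : Formula → Formula → Formula
  _⇒ᶠ_  : Formula → Formula → Formula
  ¬ᶠ_   : Formula → Formula
  ∘ᶠ_   : Formula → Formula

_ᵀ : Formula → Formula
A ᵀ = ∘ᶠ A ∧ᶠ A

_ᶠ : Formula → Formula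
A ᶠ = ∘ᶠ A ∧ᶠ ¬ᶠ A

FormulaSet : Set₁
FormulaSet = Formula → Set

-- Natural deduction system LET_K^+.
-- 'Der Γ Δ A' : A is derivable from the premises Γ together with the
-- (currently open, dischargeable) hypotheses Δ.  Discharging a
-- hypothesis [A] in a subderivation means that subderivation is
-- carried out with A added to Δ.

data Der (Γ : FormulaSet) : List Formula → Formula → Set where
  prem  : ∀ {Δ A} → Γ A → Der Γ Δ A
  hyp   : ∀ {Δ A} → A ∈ Δ → Der Γ Δ A
  ∧I    : ∀ {Δ A B} → Der Γ Δ A → Der Γ Δ B → Der Γ Δ (A ∧ᶠ B)
  ∧E₁   : ∀ {Δ A B} → Der Γ Δ (A ∧ᶠ B) → Der Γ Δ A
  ∧E₂   : ∀ {Δ A B} → Der Γ Δ (A ∧ᶠ B) → Der Γ Δ B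
  ∨I₁   : ∀ {Δ A B} → Der Γ Δ A → Der Γ Δ (A ∨ᶠ B)
  ∨I₂   : ∀ {Δ A B} → Der Γ Δ B → Der Γ Δ (A ∨ᶠ B)
  ∨E    : ∀ {Δ A B C} → Der Γ Δ (A ∨ᶠ B) → Der Γ (A ∷ Δ) C → Der Γ (B ∷ Δ) C → Der Γ Δ C
  ¬∧I₁  : ∀ {Δ A B} → Der Γ Δ (¬ᶠ A) → Der Γ Δ (¬ᶠ (A ∧ᶠ B))
  ¬∧I₂  : ∀ {Δ A B} → Der Γ Δ (¬ᶠ B) → Der Γ Δ (¬ᶠ (A ∧ᶠ B))
  ¬∧E   : ∀ {Δ A B C} → Der Γ Δ (¬ᶠ (A ∧ᶠ B)) → Der Γ (¬ᶠ A ∷ Δ) C → Der Γ (¬ᶠ B ∷ Δ) C → Der Γ Δ C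
  ¬∨I   : ∀ {Δ A B} → Der Γ Δ (¬ᶠ A) → Der Γ Δ (¬ᶠ B) → Der Γ Δ (¬ᶠ (A ∨ᶠ B))
  ¬∨E₁  : ∀ {Δ A B} → Der Γ Δ (¬ᶠ (A ∨ᶠ B)) → Der Γ Δ (¬ᶠ A)
  ¬∨E₂  : ∀ {Δ A B} → Der Γ Δ (¬ᶠ (A ∨ᶠ B)) → Der Γ Δ (¬ᶠ B)
  DNI   : ∀ {Δ A} → Der Γ Δ A → Der Γ Δ (¬ᶠ ¬ᶠ A)
  DNE   : ∀ {Δ A} → Der Γ Δ (¬ᶠ ¬ᶠ A) → Der Γ Δ A
  ⇒I    : ∀ {Δ A B} → Der Γ (A ∷ Δ) B → Der Γ Δ (A ⇒ᶠ B)
  ⇒E    : ∀ {Δ A B} → Der Γ Δ (A ⇒ᶠ B) → Der Γ Δ A → Der Γ Δ B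
  ⇒CL   : ∀ {Δ A B} → Der Γ Δ (A ∨ᶠ (A ⇒ᶠ B))
  ¬⇒I   : ∀ {Δ A B} → Der Γ Δ A → Der Γ Δ (¬ᶠ B) → Der Γ Δ (¬ᶠ (A ⇒ᶠ B))
  ¬⇒E₁  : ∀ {Δ A B} → Der Γ Δ (¬ᶠ (A ⇒ᶠ B)) → Der Γ Δ A
  ¬⇒E₂  : ∀ {Δ A B} → Der Γ Δ (¬ᶠ (A ⇒ᶠ B)) → Der Γ Δ (¬ᶠ B)
  EXP∘  : ∀ {Δ A B} → Der Γ Δ (∘ᶠ A) → Der Γ Δ A → Der Γ Δ (¬ᶠ A) → Der Γ Δ B
  PEM∘  : ∀ {Δ A} → Der Γ Δ (∘ᶠ A) → Der Γ Δ (A ∨ᶠ ¬ᶠ A)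
  I∘    : ∀ {Δ A} → Der Γ Δ (∘ᶠ ∘ᶠ A)
  I¬∘   : ∀ {Δ A} → Der Γ Δ (∘ᶠ A) → Der Γ Δ (∘ᶠ ¬ᶠ A)
  E¬∘   : ∀ {Δ A} → Der Γ Δ (∘ᶠ ¬ᶠ A) → Der Γ Δ (∘ᶠ A)
  I∧T   : ∀ {Δ A B} → Der Γ Δ (A ᵀ) → Der Γ Δ (B ᵀ) → Der Γ Δ ((A ∧ᶠ B) ᵀ)
  I∧F₁  : ∀ {Δ A B} → Der Γ Δ (A ᶠ) → Der Γ Δ ((A ∧ᶠ B) ᶠ)
  I∧F₂  : ∀ {Δ A B} → Der Γ Δ (B ᶠ) → Der Γ Δ ((A ∧ᶠ B) ᶠ)
  I∨T₁  : ∀ {Δ A B} → Der Γ Δ (A ᵀ) → Der Γ Δ ((A ∨ᶠ B) ᵀ)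
  I∨T₂  : ∀ {Δ A B} → Der Γ Δ (B ᵀ) → Der Γ Δ ((A ∨ᶠ B) ᵀ)
  I∨F   : ∀ {Δ A B} → Der Γ Δ (A ᶠ) → Der Γ Δ (B ᶠ) → Der Γ Δ ((A ∨ᶠ B) ᶠ)
  I⇒T₁  : ∀ {Δ A B} → Der Γ Δ (A ᶠ) → Der Γ Δ ((A ⇒ᶠ B) ᵀ)
  I⇒T₂  : ∀ {Δ A B} → Der Γ Δ (B ᵀ) → Der Γ Δ ((A ⇒ᶠ B) ᵀ)
  I⇒F   : ∀ {Δ A B} → Der Γ Δ A → Der Γ Δ (B ᶠ) → Der Γ Δ ((A ⇒ᶠ B) ᶠ)
  E∧T₁  : ∀ {Δ A B} → Der Γ Δ ((A ∧ᶠ B) ᵀ) → Der Γ Δ (A ᵀ)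
  E∧T₂  : ∀ {Δ A B} → Der Γ Δ ((A ∧ᶠ B) ᵀ) → Der Γ Δ (B ᵀ)
  E∧F   : ∀ {Δ A B C} → Der Γ Δ ((A ∧ᶠ B) ᶠ) → Der Γ (A ᶠ ∷ Δ) C → Der Γ (B ᶠ ∷ Δ) C → Der Γ Δ C
  E∨T   : ∀ {Δ A B C} → Der Γ Δ ((A ∨ᶠ B) ᵀ) → Der Γ (A ᵀ ∷ Δ) C → Der Γ (B ᵀ ∷ Δ) C → Der Γ Δ C
  E∨F₁  : ∀ {Δ A B} → Der Γ Δ ((A ∨ᶠ B) ᶠ) → Der Γ Δ (A ᶠ)
  E∨F₂  : ∀ {Δ A B} → Der Γ Δ ((A ∨ᶠ B) ᶠ) → Der Γ Δ (B ᶠ)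
  E⇒T   : ∀ {Δ A B C} → Der Γ Δ ((A ⇒ᶠ B) ᵀ) → Der Γ (A ᶠ ∷ Δ) C → Der Γ (B ᵀ ∷ Δ) C → Der Γ Δ C
  E⇒F₁  : ∀ {Δ A B} → Der Γ Δ ((A ⇒ᶠ B) ᶠ) → Der Γ Δ A
  E⇒F₂  : ∀ {Δ A B} → Der Γ Δ ((A ⇒ᶠ B) ᶠ) → Der Γ Δ (B ᶠ)

infix 3 _⊢_
_⊢_ : FormulaSet → Formula → Set
Γ ⊢ A = Der Γ [] A

module Twist {c ℓ : Level} (𝓑 : BooleanAlgebra c ℓ) where
  open BooleanAlgebra 𝓑

  _⇛_ : Carrier → Carrier → Carrier
  x ⇛ y = (¬ x) ∨ y

  _≤_ : Carrier → Carrier → Set ℓ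
  x ≤ y = (x ∧ y) ≈ x

  record Triple : Set c where
    constructor ⟨_,_,_⟩
    field
      z₁ z₂ z₃ : Carrier
  open Triple public

  InDomain : Triple → Set ℓ
  InDomain z = (z₃ z ≤ (z₁ z ∨ z₂ z)) × (((z₁ z ∧ z₂ z) ∧ z₃ z) ≈ ⊥)

  Domain : Set (c ⊔ ℓ)
  Domain = Σ Triple InDomain

  _∧̃_ : Triple → Triple → Triple
  z ∧̃ w = ⟨ z₁ z ∧ z₁ w , z₂ z ∨ z₂ w ,
            ((((z₁ z ∧ z₃ z) ∧ z₁ w) ∧ z₃ w) ∨ (z₂ z ∧ z₃ z)) ∨ (z₂ w ∧ z₃ w) ⟩

  _∨̃_ : Triple → Triple → Triple
  z ∨̃ w = ⟨ z₁ z ∨ z₁ w , z₂ z ∧ z₂ w ,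
            ((((z₂ z ∧ z₃ z) ∧ z₂ w) ∧ z₃ w) ∨ (z₁ z ∧ z₃ z)) ∨ (z₁ w ∧ z₃ w) ⟩

  _⇒̃_ : Triple → Triple → Triple
  z ⇒̃ w = ⟨ z₁ z ⇛ z₁ w , z₁ z ∧ z₂ w ,
            (((z₁ z ∧ z₂ w) ∧ z₃ w) ∨ (z₂ z ∧ z₃ z)) ∨ (z₁ w ∧ z₃ w) ⟩

  ¬̃_ : Triple → Triple
  ¬̃ z = ⟨ z₂ z , z₁ z , z₃ z ⟩

  ∘̃_ : Triple → Triple
  ∘̃ z = ⟨ z₃ z , ¬ (z₃ z) , ⊤ ⟩

  -- Homomorphisms from the formula algebra into T_𝓑 are exactly the
  -- extensions of maps from the variables into the domain.
  Valuation : Set (c ⊔ ℓ)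
  Valuation = ℕ → Domain

  ⟦_⟧ : Formula → Valuation → Triple
  ⟦ var n ⟧ v = proj₁ (v n)
  ⟦ A ∧ᶠ B ⟧ v = ⟦ A ⟧ v ∧̃ ⟦ B ⟧ v
  ⟦ A ∨ᶠ B ⟧ v = ⟦ A ⟧ v ∨̃ ⟦ B ⟧ v
  ⟦ A ⇒ᶠ B ⟧ v = ⟦ A ⟧ v ⇒̃ ⟦ B ⟧ v
  ⟦ ¬ᶠ A ⟧ v = ¬̃ (⟦ A ⟧ v)
  ⟦ ∘ᶠ A ⟧ v = ∘̃ (⟦ A ⟧ v)

  Designated : Triple → Set ℓ
  Designated z = z₁ z ≈ ⊤

_⊨⟨_,_⟩_ : FormulaSet → (c ℓ : Level) → Formula → Set (lsuc (c ⊔ ℓ))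
Γ ⊨⟨ c , ℓ ⟩ A =
  (𝓑 : BooleanAlgebra c ℓ) → let open Twist 𝓑 in
  (v : Valuation) → (∀ B → Γ B → Designated (⟦ B ⟧ v)) → Designated (⟦ A ⟧ v)

module Submission where

-- Soundness is proved by reading a derivation of A from open hypotheses Δ
-- as "every h below the first components of Δ lies below the first component
-- of A", so that ∨-elimination becomes reasoning by cases below h.  The rules
-- of LET_K^+ are then sound because on the domain the classical parts
-- zᵀ = z₃ ∧ z₁ and zᶠ = z₃ ∧ z₂ are compositional: (z ∧̃ w)ᵀ = zᵀ ∧ wᵀ,
-- (z ∧̃ w)ᶠ = zᶠ ∨ wᶠ, (z ⇒̃ w)ᵀ = zᶠ ∨ wᵀ and (z ⇒̃ w)ᶠ = z₁ ∧ wᶠ.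
--
-- Completeness uses the Lindenbaum algebra of formulas modulo
-- interderivability from Γ, a Boolean algebra with ∼ A = A ⇒ ⊥ as complement.
-- Under the valuation p ↦ (p, ¬p, ∘p) every formula A is interpreted as
-- (A, ¬A, ∘A) up to interderivability: the third components match because
-- the ∘-rules of LET_K^+ derive exactly ∘(A ∧ B) ⊣⊢ (Aᵀ ∧ Bᵀ) ∨ Aᶠ ∨ Bᶠ and
-- its analogues.  So A is designated iff Γ ⊢ A.

open import Level using (Level; Lift; lift; lower)
open import Algebra.Lattice.Bundles using (BooleanAlgebra)
open import Function.Bundles using (_⇔_; mk⇔; Equivalence)
open import Data.Product using (_×_; _,_; proj₁; proj₂)
open import Data.List using (_∷_)
open import Data.List.Relation.Unary.All as All using (All; _∷_; [])
open import Data.List.Relation.Unary.Any using (here; there)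
open import Data.List.Relation.Binary.Subset.Propositional using (_⊆_)
open import Data.List.Relation.Binary.Subset.Propositional.Properties using (∷⁺ʳ)
open import Relation.Binary.PropositionalEquality using (refl)
open import Defs

module BooleanOrder {c ℓ : Level} (𝓑 : BooleanAlgebra c ℓ) where
  open BooleanAlgebra 𝓑
  open import Algebra.Lattice.Properties.BooleanAlgebra 𝓑
  import Relation.Binary.Lattice as Order
  -- Here x ≤ y is x ≈ x ∧ y; Twist._≤_ is the same relation with the equation flipped.
  open Order.Lattice ∨-∧-orderTheoreticLattice public
    using (_≤_; x∧y≤x; x∧y≤y; ∧-greatest; x≤x∨y; y≤x∨y; ∨-least; ≤-respʳ-≈; antisym)
    renaming (refl to ≤-refl; trans to ≤-trans)

  infixr 4 _∙_
  _∙_ : ∀ {x y z} → x ≤ y → y ≤ z → x ≤ z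
  _∙_ = ≤-trans

  ≈-by-lower-bounds : ∀ {x y} → (∀ {h} → h ≤ x → h ≤ y) → (∀ {h} → h ≤ y → h ≤ x) → x ≈ y
  ≈-by-lower-bounds f g = antisym (f ≤-refl) (g ≤-refl)

  ∧-elimˡ : ∀ {h x y} → h ≤ x ∧ y → h ≤ x
  ∧-elimˡ p = p ∙ x∧y≤x _ _

  ∧-elimʳ : ∀ {h x y} → h ≤ x ∧ y → h ≤ y
  ∧-elimʳ p = p ∙ x∧y≤y _ _

  ∧-swap : ∀ {h x y} → h ≤ x ∧ y → h ≤ y ∧ x
  ∧-swap p = ∧-greatest (∧-elimʳ p) (∧-elimˡ p)

  ∨-introˡ : ∀ {h x y} → h ≤ x → h ≤ x ∨ y
  ∨-introˡ p = p ∙ x≤x∨y _ _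

  ∨-introʳ : ∀ {h x y} → h ≤ y → h ≤ x ∨ y
  ∨-introʳ p = p ∙ y≤x∨y _ _

  ∨-elim : ∀ {h x y z} → h ≤ x ∨ y →
           (∀ {h′} → h′ ≤ h → h′ ≤ x → h′ ≤ z) →
           (∀ {h′} → h′ ≤ h → h′ ≤ y → h′ ≤ z) → h ≤ z
  ∨-elim {h} {x} {y} p f g =
    ≤-respʳ-≈ (∧-distribˡ-∨ h x y) (∧-greatest ≤-refl p)
    ∙ ∨-least (f (x∧y≤x _ _) (x∧y≤y _ _)) (g (x∧y≤x _ _) (x∧y≤y _ _))

  ∨₃-elim : ∀ {h x y u z} → h ≤ (x ∨ y) ∨ u →
            (∀ {h′} → h′ ≤ h → h′ ≤ x → h′ ≤ z) →
            (∀ {h′} → h′ ≤ h → h′ ≤ y → h′ ≤ z) →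
            (∀ {h′} → h′ ≤ h → h′ ≤ u → h′ ≤ z) → h ≤ z
  ∨₃-elim p f g k = ∨-elim p (λ h′≤h q → ∨-elim q (λ h″≤h′ → f (h″≤h′ ∙ h′≤h))
                                                  (λ h″≤h′ → g (h″≤h′ ∙ h′≤h)))
                             k

  ≤⊤ : ∀ {h} → h ≤ ⊤
  ≤⊤ {h} = sym (∧-identityʳ h)

  ≈⊤⇒≤ : ∀ {h x} → x ≈ ⊤ → h ≤ x
  ≈⊤⇒≤ x≈⊤ = ≤-respʳ-≈ (sym x≈⊤) ≤⊤

  ⊤≤⇒≈⊤ : ∀ {x} → ⊤ ≤ x → x ≈ ⊤
  ⊤≤⇒≈⊤ p = antisym ≤⊤ p

  ⊥-elim : ∀ {h z} → h ≤ ⊥ → h ≤ z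
  ⊥-elim {z = z} p = p ∙ sym (∧-zeroˡ z)

  contradiction : ∀ {h x z} → h ≤ x → h ≤ ¬ x → h ≤ z
  contradiction {x = x} p q = ⊥-elim (≤-respʳ-≈ (∧-complementʳ x) (∧-greatest p q))

  excluded-middle : ∀ {h x} → h ≤ x ∨ ¬ x
  excluded-middle {x = x} = ≤-respʳ-≈ (sym (∨-complementʳ x)) ≤⊤

  ⇒-intro : ∀ {h x y} → (∀ {h′} → h′ ≤ h → h′ ≤ x → h′ ≤ y) → h ≤ ¬ x ∨ y
  ⇒-intro f = ∨-elim excluded-middle (λ h′≤h p → ∨-introʳ (f h′≤h p)) (λ _ → ∨-introˡ)

  ⇒-elim : ∀ {h x y} → h ≤ ¬ x ∨ y → h ≤ x → h ≤ y
  ⇒-elim p q = ∨-elim p (λ h′≤h → contradiction (h′≤h ∙ q)) (λ _ r → r)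

module TwistOrder {c ℓ : Level} (𝓑 : BooleanAlgebra c ℓ) where
  open BooleanAlgebra 𝓑 using (_∨_; ⊥; _≈_; sym)
  open import Algebra.Lattice.Properties.BooleanAlgebra 𝓑 using (∧-zeroˡ)
  open BooleanOrder 𝓑
  open Twist 𝓑 hiding (_≤_)

  infix 25 _ᵀ̃ _ᶠ̃
  _ᵀ̃ _ᶠ̃ : Triple → Triple
  z ᵀ̃ = (∘̃ z) ∧̃ z
  z ᶠ̃ = (∘̃ z) ∧̃ (¬̃ z)

  module _ {z : Triple} where

    excluded : InDomain z → ∀ {h} → h ≤ z₃ z → h ≤ z₁ z ∨ z₂ z
    excluded (z₃≤z₁∨z₂ , _) p = p ∙ sym z₃≤z₁∨z₂

    explosive : InDomain z → ∀ {h y} → h ≤ z₁ z → h ≤ z₂ z → h ≤ z₃ z → h ≤ y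
    explosive (_ , z₁z₂z₃≈⊥) p q r =
      ⊥-elim (≤-respʳ-≈ z₁z₂z₃≈⊥ (∧-greatest (∧-greatest p q) r))

    inDomain : (∀ {h} → h ≤ z₃ z → h ≤ z₁ z ∨ z₂ z) →
               (∀ {h} → h ≤ z₁ z → h ≤ z₂ z → h ≤ z₃ z → h ≤ ⊥) → InDomain z
    inDomain excl expl =
      sym (excl ≤-refl) ,
      antisym (expl (∧-elimˡ (∧-elimˡ ≤-refl)) (∧-elimʳ (∧-elimˡ ≤-refl)) (∧-elimʳ ≤-refl))
              (sym (∧-zeroˡ _))

  ¬̃-inDomain : ∀ {z} → InDomain z → InDomain (¬̃ z)
  ¬̃-inDomain dz = inDomain (λ p → ∨-elim (excluded dz p) (λ _ → ∨-introʳ) (λ _ → ∨-introˡ))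
                           (λ p q r → explosive dz q p r)

  ∘̃-inDomain : ∀ z → InDomain (∘̃ z)
  ∘̃-inDomain z = inDomain (λ _ → excluded-middle) (λ p q _ → contradiction p q)

  module _ {z w : Triple} (dz : InDomain z) (dw : InDomain w) where

    ᵀ̃-∧̃ : z₁ ((z ∧̃ w) ᵀ̃) ≈ z₁ (z ᵀ̃ ∧̃ w ᵀ̃)
    ᵀ̃-∧̃ = ≈-by-lower-bounds to from
      where
      to : ∀ {h} → h ≤ z₁ ((z ∧̃ w) ᵀ̃) → h ≤ z₁ (z ᵀ̃ ∧̃ w ᵀ̃)
      to p = ∨₃-elim (∧-elimˡ p)
        (λ _ r → ∧-greatest (∧-greatest (∧-elimʳ (∧-elimˡ (∧-elimˡ r))) (∧-elimˡ (∧-elimˡ (∧-elimˡ r))))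
                            (∧-greatest (∧-elimʳ r) (∧-elimʳ (∧-elimˡ r))))
        (λ h′≤h r → explosive dz (h′≤h ∙ ∧-elimˡ (∧-elimʳ p)) (∧-elimˡ r) (∧-elimʳ r))
        (λ h′≤h r → explosive dw (h′≤h ∙ ∧-elimʳ (∧-elimʳ p)) (∧-elimˡ r) (∧-elimʳ r))
      from : ∀ {h} → h ≤ z₁ (z ᵀ̃ ∧̃ w ᵀ̃) → h ≤ z₁ ((z ∧̃ w) ᵀ̃)
      from q = both (∧-elimˡ q) (∧-elimʳ q)
        where
        both : ∀ {h} → h ≤ z₁ (z ᵀ̃) → h ≤ z₁ (w ᵀ̃) → h ≤ z₁ ((z ∧̃ w) ᵀ̃)
        both zᵀ wᵀ =
          ∧-greatest (∨-introˡ (∨-introˡ (∧-greatest (∧-greatest (∧-swap zᵀ) (∧-elimʳ wᵀ)) (∧-elimˡ wᵀ))))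
                     (∧-greatest (∧-elimʳ zᵀ) (∧-elimʳ wᵀ))

    ᶠ̃-∧̃ : z₁ ((z ∧̃ w) ᶠ̃) ≈ z₁ (z ᶠ̃ ∨̃ w ᶠ̃)
    ᶠ̃-∧̃ = ≈-by-lower-bounds to from
      where
      to : ∀ {h} → h ≤ z₁ ((z ∧̃ w) ᶠ̃) → h ≤ z₁ (z ᶠ̃ ∨̃ w ᶠ̃)
      to p = ∨₃-elim (∧-elimˡ p)
        (λ h′≤h r → ∨-elim (h′≤h ∙ ∧-elimʳ p)
          (λ h″≤h′ s → explosive dz (h″≤h′ ∙ ∧-elimˡ (∧-elimˡ (∧-elimˡ r))) s
                                    (h″≤h′ ∙ ∧-elimʳ (∧-elimˡ (∧-elimˡ r))))
          (λ h″≤h′ s → explosive dw (h″≤h′ ∙ ∧-elimʳ (∧-elimˡ r)) s (h″≤h′ ∙ ∧-elimʳ r)))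
        (λ _ r → ∨-introˡ (∧-swap r))
        (λ _ r → ∨-introʳ (∧-swap r))
      from : ∀ {h} → h ≤ z₁ (z ᶠ̃ ∨̃ w ᶠ̃) → h ≤ z₁ ((z ∧̃ w) ᶠ̃)
      from q = ∨-elim q
        (λ _ r → ∧-greatest (∨-introˡ (∨-introʳ (∧-swap r))) (∨-introˡ (∧-elimʳ r)))
        (λ _ r → ∧-greatest (∨-introʳ (∧-swap r)) (∨-introʳ (∧-elimʳ r)))

    ᵀ̃-⇒̃ : z₁ ((z ⇒̃ w) ᵀ̃) ≈ z₁ (z ᶠ̃ ∨̃ w ᵀ̃)
    ᵀ̃-⇒̃ = ≈-by-lower-bounds to from
      where
      to : ∀ {h} → h ≤ z₁ ((z ⇒̃ w) ᵀ̃) → h ≤ z₁ (z ᶠ̃ ∨̃ w ᵀ̃)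
      to p = ∨₃-elim (∧-elimˡ p)
        (λ h′≤h r → explosive dw (⇒-elim (h′≤h ∙ ∧-elimʳ p) (∧-elimˡ (∧-elimˡ r)))
                                 (∧-elimʳ (∧-elimˡ r)) (∧-elimʳ r))
        (λ _ r → ∨-introˡ (∧-swap r))
        (λ _ r → ∨-introʳ (∧-swap r))
      from : ∀ {h} → h ≤ z₁ (z ᶠ̃ ∨̃ w ᵀ̃) → h ≤ z₁ ((z ⇒̃ w) ᵀ̃)
      from q = ∨-elim q
        (λ _ r → ∧-greatest (∨-introˡ (∨-introʳ (∧-swap r)))
                            (⇒-intro (λ h′≤h s → explosive dz s (h′≤h ∙ ∧-elimʳ r) (h′≤h ∙ ∧-elimˡ r))))
        (λ _ r → ∧-greatest (∨-introʳ (∧-swap r)) (∨-introʳ (∧-elimʳ r)))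

    ᶠ̃-⇒̃ : z₁ ((z ⇒̃ w) ᶠ̃) ≈ z₁ (z ∧̃ w ᶠ̃)
    ᶠ̃-⇒̃ = ≈-by-lower-bounds to from
      where
      to : ∀ {h} → h ≤ z₁ ((z ⇒̃ w) ᶠ̃) → h ≤ z₁ (z ∧̃ w ᶠ̃)
      to {h} p = ∧-greatest (∧-elimˡ (∧-elimʳ p)) (∧-greatest w₃ (∧-elimʳ (∧-elimʳ p)))
        where
        w₃ : h ≤ z₃ w
        w₃ = ∨₃-elim (∧-elimˡ p)
          (λ _ r → ∧-elimʳ r)
          (λ h′≤h r → explosive dz (h′≤h ∙ ∧-elimˡ (∧-elimʳ p)) (∧-elimˡ r) (∧-elimʳ r))
          (λ h′≤h r → explosive dw (∧-elimˡ r) (h′≤h ∙ ∧-elimʳ (∧-elimʳ p)) (∧-elimʳ r))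
      from : ∀ {h} → h ≤ z₁ (z ∧̃ w ᶠ̃) → h ≤ z₁ ((z ⇒̃ w) ᶠ̃)
      from q = both (∧-elimˡ q) (∧-elimʳ q)
        where
        both : ∀ {h} → h ≤ z₁ z → h ≤ z₁ (w ᶠ̃) → h ≤ z₁ ((z ⇒̃ w) ᶠ̃)
        both z₁-holds wᶠ =
          ∧-greatest (∨-introˡ (∨-introˡ (∧-greatest (∧-greatest z₁-holds (∧-elimʳ wᶠ)) (∧-elimˡ wᶠ))))
                     (∧-greatest z₁-holds (∧-elimʳ wᶠ))

  module _ {z w : Triple} (dz : InDomain z) (dw : InDomain w) where

    -- z ∨̃ w is definitionally ¬̃ (¬̃ z ∧̃ ¬̃ w), and ¬̃ swaps ᵀ̃ and ᶠ̃.
    ᵀ̃-∨̃ : z₁ ((z ∨̃ w) ᵀ̃) ≈ z₁ (z ᵀ̃ ∨̃ w ᵀ̃)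
    ᵀ̃-∨̃ = ᶠ̃-∧̃ (¬̃-inDomain dz) (¬̃-inDomain dw)

    ᶠ̃-∨̃ : z₁ ((z ∨̃ w) ᶠ̃) ≈ z₁ (z ᶠ̃ ∧̃ w ᶠ̃)
    ᶠ̃-∨̃ = ᵀ̃-∧̃ (¬̃-inDomain dz) (¬̃-inDomain dw)

    ∧̃-inDomain : InDomain (z ∧̃ w)
    ∧̃-inDomain = inDomain excl expl
      where
      excl : ∀ {h} → h ≤ z₃ (z ∧̃ w) → h ≤ z₁ (z ∧̃ w) ∨ z₂ (z ∧̃ w)
      excl p = ∨₃-elim p
        (λ _ r → ∨-introˡ (∧-greatest (∧-elimˡ (∧-elimˡ (∧-elimˡ r))) (∧-elimʳ (∧-elimˡ r))))
        (λ _ r → ∨-introʳ (∨-introˡ (∧-elimˡ r)))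
        (λ _ r → ∨-introʳ (∨-introʳ (∧-elimˡ r)))
      expl : ∀ {h} → h ≤ z₁ (z ∧̃ w) → h ≤ z₂ (z ∧̃ w) → h ≤ z₃ (z ∧̃ w) → h ≤ ⊥
      expl p q r = ∨-elim (≤-respʳ-≈ (ᶠ̃-∧̃ dz dw) (∧-greatest r q))
        (λ h′≤h s → explosive dz (h′≤h ∙ ∧-elimˡ p) (∧-elimʳ s) (∧-elimˡ s))
        (λ h′≤h s → explosive dw (h′≤h ∙ ∧-elimʳ p) (∧-elimʳ s) (∧-elimˡ s))

    ⇒̃-inDomain : InDomain (z ⇒̃ w)
    ⇒̃-inDomain = inDomain excl expl
      where
      excl : ∀ {h} → h ≤ z₃ (z ⇒̃ w) → h ≤ z₁ (z ⇒̃ w) ∨ z₂ (z ⇒̃ w)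
      excl p = ∨₃-elim p
        (λ _ r → ∨-introʳ (∧-elimˡ r))
        (λ _ r → ∨-introˡ (⇒-intro (λ h′≤h s → explosive dz s (h′≤h ∙ ∧-elimˡ r) (h′≤h ∙ ∧-elimʳ r))))
        (λ _ r → ∨-introˡ (∨-introʳ (∧-elimˡ r)))
      expl : ∀ {h} → h ≤ z₁ (z ⇒̃ w) → h ≤ z₂ (z ⇒̃ w) → h ≤ z₃ (z ⇒̃ w) → h ≤ ⊥
      expl p q r = refute p (≤-respʳ-≈ (ᶠ̃-⇒̃ dz dw) (∧-greatest r q))
        where
        refute : ∀ {h} → h ≤ z₁ (z ⇒̃ w) → h ≤ z₁ (z ∧̃ w ᶠ̃) → h ≤ ⊥
        refute p s = explosive dw (⇒-elim p (∧-elimˡ s)) (∧-elimʳ (∧-elimʳ s)) (∧-elimˡ (∧-elimʳ s))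

  ∨̃-inDomain : ∀ {z w} → InDomain z → InDomain w → InDomain (z ∨̃ w)
  ∨̃-inDomain dz dw = ¬̃-inDomain (∧̃-inDomain (¬̃-inDomain dz) (¬̃-inDomain dw))

module Soundness {c ℓ : Level} (𝓑 : BooleanAlgebra c ℓ) where
  open BooleanAlgebra 𝓑 using (Carrier; _∨_; sym)
  open BooleanOrder 𝓑
  open TwistOrder 𝓑
  open Twist 𝓑 hiding (_≤_)

  ⟦⟧-inDomain : ∀ v A → InDomain (⟦ A ⟧ v)
  ⟦⟧-inDomain v (var n)  = proj₂ (v n)
  ⟦⟧-inDomain v (A ∧ᶠ B) = ∧̃-inDomain (⟦⟧-inDomain v A) (⟦⟧-inDomain v B)
  ⟦⟧-inDomain v (A ∨ᶠ B) = ∨̃-inDomain (⟦⟧-inDomain v A) (⟦⟧-inDomain v B)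
  ⟦⟧-inDomain v (A ⇒ᶠ B) = ⇒̃-inDomain (⟦⟧-inDomain v A) (⟦⟧-inDomain v B)
  ⟦⟧-inDomain v (¬ᶠ A)   = ¬̃-inDomain (⟦⟧-inDomain v A)
  ⟦⟧-inDomain v (∘ᶠ A)   = ∘̃-inDomain (⟦ A ⟧ v)

  module _ (v : Valuation) {Γ : FormulaSet} (Γ-designated : ∀ B → Γ B → Designated (⟦ B ⟧ v)) where

    infix 4 _⊩_
    _⊩_ : Carrier → Formula → Set ℓ
    h ⊩ A = h ≤ z₁ (⟦ A ⟧ v)

    dom : ∀ A → InDomain (⟦ A ⟧ v)
    dom = ⟦⟧-inDomain v

    extend : ∀ {h h′ Δ A} → h′ ≤ h → All (h ⊩_) Δ → h′ ⊩ A → All (h′ ⊩_) (A ∷ Δ)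
    extend h′≤h γ p = p ∷ All.map (h′≤h ∙_) γ

    mutual
      ⊩-sound : ∀ {Δ A h} → Der Γ Δ A → All (h ⊩_) Δ → h ⊩ A
      ⊩-sound (prem ΓA)     γ = ≈⊤⇒≤ (Γ-designated _ ΓA)
      ⊩-sound (hyp A∈Δ)     γ = All.lookup γ A∈Δ
      ⊩-sound (∧I d e)      γ = ∧-greatest (⊩-sound d γ) (⊩-sound e γ)
      ⊩-sound (∧E₁ d)       γ = ∧-elimˡ (⊩-sound d γ)
      ⊩-sound (∧E₂ d)       γ = ∧-elimʳ (⊩-sound d γ)
      ⊩-sound (∨I₁ d)       γ = ∨-introˡ (⊩-sound d γ)
      ⊩-sound (∨I₂ d)       γ = ∨-introʳ (⊩-sound d γ)
      ⊩-sound (∨E d e f)    γ = ⊩-cases (⊩-sound d γ) e f γ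
      ⊩-sound (¬∧I₁ d)      γ = ∨-introˡ (⊩-sound d γ)
      ⊩-sound (¬∧I₂ d)      γ = ∨-introʳ (⊩-sound d γ)
      ⊩-sound (¬∧E d e f)   γ = ⊩-cases (⊩-sound d γ) e f γ
      ⊩-sound (¬∨I d e)     γ = ∧-greatest (⊩-sound d γ) (⊩-sound e γ)
      ⊩-sound (¬∨E₁ d)      γ = ∧-elimˡ (⊩-sound d γ)
      ⊩-sound (¬∨E₂ d)      γ = ∧-elimʳ (⊩-sound d γ)
      ⊩-sound (DNI d)       γ = ⊩-sound d γ
      ⊩-sound (DNE d)       γ = ⊩-sound d γ
      ⊩-sound (⇒I d)        γ = ⇒-intro (λ h′≤h p → ⊩-sound d (extend h′≤h γ p))
      ⊩-sound (⇒E d e)      γ = ⇒-elim (⊩-sound d γ) (⊩-sound e γ)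
      ⊩-sound ⇒CL           γ = ∨-elim excluded-middle (λ _ → ∨-introˡ) (λ _ p → ∨-introʳ (∨-introˡ p))
      ⊩-sound (¬⇒I d e)     γ = ∧-greatest (⊩-sound d γ) (⊩-sound e γ)
      ⊩-sound (¬⇒E₁ d)      γ = ∧-elimˡ (⊩-sound d γ)
      ⊩-sound (¬⇒E₂ d)      γ = ∧-elimʳ (⊩-sound d γ)
      ⊩-sound (EXP∘ {A = A} d e f) γ = explosive (dom A) (⊩-sound e γ) (⊩-sound f γ) (⊩-sound d γ)
      ⊩-sound (PEM∘ {A = A} d)     γ = excluded (dom A) (⊩-sound d γ)
      ⊩-sound I∘            γ = ≤⊤
      ⊩-sound (I¬∘ d)       γ = ⊩-sound d γ
      ⊩-sound (E¬∘ d)       γ = ⊩-sound d γ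
      ⊩-sound (I∧T {A = A} {B} d e) γ =
        ≤-respʳ-≈ (sym (ᵀ̃-∧̃ (dom A) (dom B))) (∧-greatest (⊩-sound d γ) (⊩-sound e γ))
      ⊩-sound (I∧F₁ {A = A} {B} d)  γ = ≤-respʳ-≈ (sym (ᶠ̃-∧̃ (dom A) (dom B))) (∨-introˡ (⊩-sound d γ))
      ⊩-sound (I∧F₂ {A = A} {B} d)  γ = ≤-respʳ-≈ (sym (ᶠ̃-∧̃ (dom A) (dom B))) (∨-introʳ (⊩-sound d γ))
      ⊩-sound (I∨T₁ {A = A} {B} d)  γ = ≤-respʳ-≈ (sym (ᵀ̃-∨̃ (dom A) (dom B))) (∨-introˡ (⊩-sound d γ))
      ⊩-sound (I∨T₂ {A = A} {B} d)  γ = ≤-respʳ-≈ (sym (ᵀ̃-∨̃ (dom A) (dom B))) (∨-introʳ (⊩-sound d γ))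
      ⊩-sound (I∨F {A = A} {B} d e) γ =
        ≤-respʳ-≈ (sym (ᶠ̃-∨̃ (dom A) (dom B))) (∧-greatest (⊩-sound d γ) (⊩-sound e γ))
      ⊩-sound (I⇒T₁ {A = A} {B} d)  γ = ≤-respʳ-≈ (sym (ᵀ̃-⇒̃ (dom A) (dom B))) (∨-introˡ (⊩-sound d γ))
      ⊩-sound (I⇒T₂ {A = A} {B} d)  γ = ≤-respʳ-≈ (sym (ᵀ̃-⇒̃ (dom A) (dom B))) (∨-introʳ (⊩-sound d γ))
      ⊩-sound (I⇒F {A = A} {B} d e) γ =
        ≤-respʳ-≈ (sym (ᶠ̃-⇒̃ (dom A) (dom B))) (∧-greatest (⊩-sound d γ) (⊩-sound e γ))
      ⊩-sound (E∧T₁ {A = A} {B} d)  γ = ∧-elimˡ (≤-respʳ-≈ (ᵀ̃-∧̃ (dom A) (dom B)) (⊩-sound d γ))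
      ⊩-sound (E∧T₂ {A = A} {B} d)  γ = ∧-elimʳ (≤-respʳ-≈ (ᵀ̃-∧̃ (dom A) (dom B)) (⊩-sound d γ))
      ⊩-sound (E∧F {A = A} {B} d e f) γ = ⊩-cases (≤-respʳ-≈ (ᶠ̃-∧̃ (dom A) (dom B)) (⊩-sound d γ)) e f γ
      ⊩-sound (E∨T {A = A} {B} d e f) γ = ⊩-cases (≤-respʳ-≈ (ᵀ̃-∨̃ (dom A) (dom B)) (⊩-sound d γ)) e f γ
      ⊩-sound (E∨F₁ {A = A} {B} d)  γ = ∧-elimˡ (≤-respʳ-≈ (ᶠ̃-∨̃ (dom A) (dom B)) (⊩-sound d γ))
      ⊩-sound (E∨F₂ {A = A} {B} d)  γ = ∧-elimʳ (≤-respʳ-≈ (ᶠ̃-∨̃ (dom A) (dom B)) (⊩-sound d γ))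
      ⊩-sound (E⇒T {A = A} {B} d e f) γ = ⊩-cases (≤-respʳ-≈ (ᵀ̃-⇒̃ (dom A) (dom B)) (⊩-sound d γ)) e f γ
      ⊩-sound (E⇒F₁ {A = A} {B} d)  γ = ∧-elimˡ (≤-respʳ-≈ (ᶠ̃-⇒̃ (dom A) (dom B)) (⊩-sound d γ))
      ⊩-sound (E⇒F₂ {A = A} {B} d)  γ = ∧-elimʳ (≤-respʳ-≈ (ᶠ̃-⇒̃ (dom A) (dom B)) (⊩-sound d γ))

      ⊩-cases : ∀ {Δ A B C h} → h ≤ z₁ (⟦ A ⟧ v) ∨ z₁ (⟦ B ⟧ v) →
                Der Γ (A ∷ Δ) C → Der Γ (B ∷ Δ) C → All (h ⊩_) Δ → h ⊩ C
      ⊩-cases p e f γ = ∨-elim p (λ h′≤h q → ⊩-sound e (extend h′≤h γ q))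
                                 (λ h′≤h q → ⊩-sound f (extend h′≤h γ q))

module Derivations (Γ : FormulaSet) where

  weaken : ∀ {Δ Δ′ A} → Δ ⊆ Δ′ → Der Γ Δ A → Der Γ Δ′ A
  weaken ρ (prem ΓA)      = prem ΓA
  weaken ρ (hyp A∈Δ)      = hyp (ρ A∈Δ)
  weaken ρ (∧I d e)       = ∧I (weaken ρ d) (weaken ρ e)
  weaken ρ (∧E₁ d)        = ∧E₁ (weaken ρ d)
  weaken ρ (∧E₂ d)        = ∧E₂ (weaken ρ d)
  weaken ρ (∨I₁ d)        = ∨I₁ (weaken ρ d)
  weaken ρ (∨I₂ d)        = ∨I₂ (weaken ρ d)
  weaken ρ (∨E d e f)     = ∨E (weaken ρ d) (weaken (∷⁺ʳ _ ρ) e) (weaken (∷⁺ʳ _ ρ) f)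
  weaken ρ (¬∧I₁ d)       = ¬∧I₁ (weaken ρ d)
  weaken ρ (¬∧I₂ d)       = ¬∧I₂ (weaken ρ d)
  weaken ρ (¬∧E d e f)    = ¬∧E (weaken ρ d) (weaken (∷⁺ʳ _ ρ) e) (weaken (∷⁺ʳ _ ρ) f)
  weaken ρ (¬∨I d e)      = ¬∨I (weaken ρ d) (weaken ρ e)
  weaken ρ (¬∨E₁ d)       = ¬∨E₁ (weaken ρ d)
  weaken ρ (¬∨E₂ d)       = ¬∨E₂ (weaken ρ d)
  weaken ρ (DNI d)        = DNI (weaken ρ d)
  weaken ρ (DNE d)        = DNE (weaken ρ d)
  weaken ρ (⇒I d)         = ⇒I (weaken (∷⁺ʳ _ ρ) d)
  weaken ρ (⇒E d e)       = ⇒E (weaken ρ d) (weaken ρ e)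
  weaken ρ ⇒CL            = ⇒CL
  weaken ρ (¬⇒I d e)      = ¬⇒I (weaken ρ d) (weaken ρ e)
  weaken ρ (¬⇒E₁ d)       = ¬⇒E₁ (weaken ρ d)
  weaken ρ (¬⇒E₂ d)       = ¬⇒E₂ (weaken ρ d)
  weaken ρ (EXP∘ d e f)   = EXP∘ (weaken ρ d) (weaken ρ e) (weaken ρ f)
  weaken ρ (PEM∘ d)       = PEM∘ (weaken ρ d)
  weaken ρ I∘             = I∘
  weaken ρ (I¬∘ d)        = I¬∘ (weaken ρ d)
  weaken ρ (E¬∘ d)        = E¬∘ (weaken ρ d)
  weaken ρ (I∧T d e)      = I∧T (weaken ρ d) (weaken ρ e)
  weaken ρ (I∧F₁ d)       = I∧F₁ (weaken ρ d)
  weaken ρ (I∧F₂ d)       = I∧F₂ (weaken ρ d)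
  weaken ρ (I∨T₁ d)       = I∨T₁ (weaken ρ d)
  weaken ρ (I∨T₂ d)       = I∨T₂ (weaken ρ d)
  weaken ρ (I∨F d e)      = I∨F (weaken ρ d) (weaken ρ e)
  weaken ρ (I⇒T₁ d)       = I⇒T₁ (weaken ρ d)
  weaken ρ (I⇒T₂ d)       = I⇒T₂ (weaken ρ d)
  weaken ρ (I⇒F d e)      = I⇒F (weaken ρ d) (weaken ρ e)
  weaken ρ (E∧T₁ d)       = E∧T₁ (weaken ρ d)
  weaken ρ (E∧T₂ d)       = E∧T₂ (weaken ρ d)
  weaken ρ (E∧F d e f)    = E∧F (weaken ρ d) (weaken (∷⁺ʳ _ ρ) e) (weaken (∷⁺ʳ _ ρ) f)
  weaken ρ (E∨T d e f)    = E∨T (weaken ρ d) (weaken (∷⁺ʳ _ ρ) e) (weaken (∷⁺ʳ _ ρ) f)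
  weaken ρ (E∨F₁ d)       = E∨F₁ (weaken ρ d)
  weaken ρ (E∨F₂ d)       = E∨F₂ (weaken ρ d)
  weaken ρ (E⇒T d e f)    = E⇒T (weaken ρ d) (weaken (∷⁺ʳ _ ρ) e) (weaken (∷⁺ʳ _ ρ) f)
  weaken ρ (E⇒F₁ d)       = E⇒F₁ (weaken ρ d)
  weaken ρ (E⇒F₂ d)       = E⇒F₂ (weaken ρ d)

  weaken¹ : ∀ {Δ A B} → Der Γ Δ A → Der Γ (B ∷ Δ) A
  weaken¹ = weaken there

  hyp₀ : ∀ {Δ A} → Der Γ (A ∷ Δ) A
  hyp₀ = hyp (here refl)

  ∧-swap : ∀ {Δ A B} → Der Γ Δ (A ∧ᶠ B) → Der Γ Δ (B ∧ᶠ A)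
  ∧-swap d = ∧I (∧E₂ d) (∧E₁ d)

  ∨-swap : ∀ {Δ A B} → Der Γ Δ (A ∨ᶠ B) → Der Γ Δ (B ∨ᶠ A)
  ∨-swap d = ∨E d (∨I₂ hyp₀) (∨I₁ hyp₀)

  -- Any explosive formula serves as a falsum.
  ⊥ᶠ : Formula
  ⊥ᶠ = ∘ᶠ var 0 ∧ᶠ (var 0 ∧ᶠ ¬ᶠ var 0)

  ⊥ᶠ-elim : ∀ {Δ C} → Der Γ Δ ⊥ᶠ → Der Γ Δ C
  ⊥ᶠ-elim d = EXP∘ (∧E₁ d) (∧E₁ (∧E₂ d)) (∧E₂ (∧E₂ d))

  ⊤ᶠ : Formula
  ⊤ᶠ = ⊥ᶠ ⇒ᶠ ⊥ᶠ

  ⊤ᶠ-intro : ∀ {Δ} → Der Γ Δ ⊤ᶠ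
  ⊤ᶠ-intro = ⇒I hyp₀

  infix 8 ∼_
  ∼_ : Formula → Formula
  ∼ A = A ⇒ᶠ ⊥ᶠ

  infix 3 _⊣⊢_
  record _⊣⊢_ (A B : Formula) : Set where
    constructor mk⊣⊢
    field
      to   : ∀ {Δ} → Der Γ Δ A → Der Γ Δ B
      from : ∀ {Δ} → Der Γ Δ B → Der Γ Δ A
  open _⊣⊢_ public

  ⊣⊢⊤ᶠ⇔derivable : ∀ {A} → (A ⊣⊢ ⊤ᶠ) ⇔ (Γ ⊢ A)
  ⊣⊢⊤ᶠ⇔derivable = mk⇔ (λ e → from e ⊤ᶠ-intro) (λ d → mk⊣⊢ (λ _ → ⊤ᶠ-intro) (λ _ → weaken (λ ()) d))

  ⊣⊢-refl : ∀ {A} → A ⊣⊢ A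
  ⊣⊢-refl = mk⊣⊢ (λ d → d) (λ d → d)

  ⊣⊢-sym : ∀ {A B} → A ⊣⊢ B → B ⊣⊢ A
  ⊣⊢-sym e = mk⊣⊢ (from e) (to e)

  ⊣⊢-trans : ∀ {A B C} → A ⊣⊢ B → B ⊣⊢ C → A ⊣⊢ C
  ⊣⊢-trans e f = mk⊣⊢ (λ d → to f (to e d)) (λ d → from e (from f d))

  ∧-cong : ∀ {A B C D} → A ⊣⊢ B → C ⊣⊢ D → A ∧ᶠ C ⊣⊢ B ∧ᶠ D
  ∧-cong e f = mk⊣⊢ (λ d → ∧I (to e (∧E₁ d)) (to f (∧E₂ d)))
                    (λ d → ∧I (from e (∧E₁ d)) (from f (∧E₂ d)))

  ∨-cong : ∀ {A B C D} → A ⊣⊢ B → C ⊣⊢ D → A ∨ᶠ C ⊣⊢ B ∨ᶠ D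
  ∨-cong e f = mk⊣⊢ (λ d → ∨E d (∨I₁ (to e hyp₀)) (∨I₂ (to f hyp₀)))
                    (λ d → ∨E d (∨I₁ (from e hyp₀)) (∨I₂ (from f hyp₀)))

  ∼-cong : ∀ {A B} → A ⊣⊢ B → ∼ A ⊣⊢ ∼ B
  ∼-cong e = mk⊣⊢ (λ d → ⇒I (⇒E (weaken¹ d) (from e hyp₀)))
                  (λ d → ⇒I (⇒E (weaken¹ d) (to e hyp₀)))

  ∧-comm : ∀ {A B} → A ∧ᶠ B ⊣⊢ B ∧ᶠ A
  ∧-comm = mk⊣⊢ ∧-swap ∧-swap

  ∨-comm : ∀ {A B} → A ∨ᶠ B ⊣⊢ B ∨ᶠ A
  ∨-comm = mk⊣⊢ ∨-swap ∨-swap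

  ∧-assoc : ∀ {A B C} → (A ∧ᶠ B) ∧ᶠ C ⊣⊢ A ∧ᶠ (B ∧ᶠ C)
  ∧-assoc = mk⊣⊢ (λ d → ∧I (∧E₁ (∧E₁ d)) (∧I (∧E₂ (∧E₁ d)) (∧E₂ d)))
                 (λ d → ∧I (∧I (∧E₁ d) (∧E₁ (∧E₂ d))) (∧E₂ (∧E₂ d)))

  ∨-assoc : ∀ {A B C} → (A ∨ᶠ B) ∨ᶠ C ⊣⊢ A ∨ᶠ (B ∨ᶠ C)
  ∨-assoc = mk⊣⊢ (λ d → ∨E d (∨E hyp₀ (∨I₁ hyp₀) (∨I₂ (∨I₁ hyp₀))) (∨I₂ (∨I₂ hyp₀)))
                 (λ d → ∨E d (∨I₁ (∨I₁ hyp₀)) (∨E hyp₀ (∨I₁ (∨I₂ hyp₀)) (∨I₂ hyp₀)))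

  ∨-absorbs-∧ : ∀ {A B} → A ∨ᶠ (A ∧ᶠ B) ⊣⊢ A
  ∨-absorbs-∧ = mk⊣⊢ (λ d → ∨E d hyp₀ (∧E₁ hyp₀)) ∨I₁

  ∧-absorbs-∨ : ∀ {A B} → A ∧ᶠ (A ∨ᶠ B) ⊣⊢ A
  ∧-absorbs-∨ = mk⊣⊢ ∧E₁ (λ d → ∧I d (∨I₁ d))

  ∨-distribˡ-∧ : ∀ {A B C} → A ∨ᶠ (B ∧ᶠ C) ⊣⊢ (A ∨ᶠ B) ∧ᶠ (A ∨ᶠ C)
  ∨-distribˡ-∧ = mk⊣⊢
    (λ d → ∨E d (∧I (∨I₁ hyp₀) (∨I₁ hyp₀)) (∧I (∨I₂ (∧E₁ hyp₀)) (∨I₂ (∧E₂ hyp₀))))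
    (λ d → ∨E (∧E₁ d) (∨I₁ hyp₀)
                      (∨E (weaken¹ (∧E₂ d)) (∨I₁ hyp₀) (∨I₂ (∧I (weaken¹ hyp₀) hyp₀))))

  ∧-distribˡ-∨ : ∀ {A B C} → A ∧ᶠ (B ∨ᶠ C) ⊣⊢ (A ∧ᶠ B) ∨ᶠ (A ∧ᶠ C)
  ∧-distribˡ-∨ = mk⊣⊢
    (λ d → ∨E (∧E₂ d) (∨I₁ (∧I (weaken¹ (∧E₁ d)) hyp₀)) (∨I₂ (∧I (weaken¹ (∧E₁ d)) hyp₀)))
    (λ d → ∨E d (∧I (∧E₁ hyp₀) (∨I₁ (∧E₂ hyp₀))) (∧I (∧E₁ hyp₀) (∨I₂ (∧E₂ hyp₀))))

  ∨-complementʳ : ∀ {A} → A ∨ᶠ ∼ A ⊣⊢ ⊤ᶠ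
  ∨-complementʳ = mk⊣⊢ (λ _ → ⊤ᶠ-intro) (λ _ → ⇒CL)

  ∧-complementʳ : ∀ {A} → A ∧ᶠ ∼ A ⊣⊢ ⊥ᶠ
  ∧-complementʳ = mk⊣⊢ (λ d → ⇒E (∧E₂ d) (∧E₁ d)) ⊥ᶠ-elim

  lindenbaum : (c ℓ : Level) → BooleanAlgebra c ℓ
  lindenbaum c ℓ = record
    { Carrier = Lift c Formula
    ; _≈_     = λ x y → Lift ℓ (lower x ⊣⊢ lower y)
    ; _∨_     = λ x y → lift (lower x ∨ᶠ lower y)
    ; _∧_     = λ x y → lift (lower x ∧ᶠ lower y)
    ; ¬_      = λ x → lift (∼ lower x)
    ; ⊤       = lift ⊤ᶠ
    ; ⊥       = lift ⊥ᶠ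
    ; isBooleanAlgebra = record
      { isDistributiveLattice = record
        { isLattice = record
          { isEquivalence = record
            { refl  = lift ⊣⊢-refl
            ; sym   = λ e → lift (⊣⊢-sym (lower e))
            ; trans = λ e f → lift (⊣⊢-trans (lower e) (lower f))
            }
          ; ∨-comm     = λ _ _ → lift ∨-comm
          ; ∨-assoc    = λ _ _ _ → lift ∨-assoc
          ; ∨-cong     = λ e f → lift (∨-cong (lower e) (lower f))
          ; ∧-comm     = λ _ _ → lift ∧-comm
          ; ∧-assoc    = λ _ _ _ → lift ∧-assoc
          ; ∧-cong     = λ e f → lift (∧-cong (lower e) (lower f))
          ; absorptive = (λ _ _ → lift ∨-absorbs-∧) , (λ _ _ → lift ∧-absorbs-∨)
          }
        ; ∨-distrib-∧ = (λ _ _ _ → lift ∨-distribˡ-∧)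
                      , (λ _ _ _ → lift (⊣⊢-trans ∨-comm (⊣⊢-trans ∨-distribˡ-∧ (∧-cong ∨-comm ∨-comm))))
        ; ∧-distrib-∨ = (λ _ _ _ → lift ∧-distribˡ-∨)
                      , (λ _ _ _ → lift (⊣⊢-trans ∧-comm (⊣⊢-trans ∧-distribˡ-∨ (∨-cong ∧-comm ∧-comm))))
        }
      ; ∨-complement = (λ _ → lift (⊣⊢-trans ∨-comm ∨-complementʳ)) , (λ _ → lift ∨-complementʳ)
      ; ∧-complement = (λ _ → lift (⊣⊢-trans ∧-comm ∧-complementʳ)) , (λ _ → lift ∧-complementʳ)
      ; ¬-cong       = λ e → lift (∼-cong (lower e))
      }
    }

  ∘-excluded : ∀ {A} → ∘ᶠ A ∧ᶠ (A ∨ᶠ ¬ᶠ A) ⊣⊢ ∘ᶠ A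
  ∘-excluded = mk⊣⊢ ∧E₁ (λ d → ∧I d (PEM∘ d))

  ∘-explosive : ∀ {A} → (A ∧ᶠ ¬ᶠ A) ∧ᶠ ∘ᶠ A ⊣⊢ ⊥ᶠ
  ∘-explosive = mk⊣⊢ (λ d → EXP∘ (∧E₂ d) (∧E₁ (∧E₁ d)) (∧E₂ (∧E₁ d))) ⊥ᶠ-elim

  ¬∧-⊣⊢ : ∀ {A B} → ¬ᶠ A ∨ᶠ ¬ᶠ B ⊣⊢ ¬ᶠ (A ∧ᶠ B)
  ¬∧-⊣⊢ = mk⊣⊢ (λ d → ∨E d (¬∧I₁ hyp₀) (¬∧I₂ hyp₀)) (λ d → ¬∧E d (∨I₁ hyp₀) (∨I₂ hyp₀))

  ¬∨-⊣⊢ : ∀ {A B} → ¬ᶠ A ∧ᶠ ¬ᶠ B ⊣⊢ ¬ᶠ (A ∨ᶠ B)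
  ¬∨-⊣⊢ = mk⊣⊢ (λ d → ¬∨I (∧E₁ d) (∧E₂ d)) (λ d → ∧I (¬∨E₁ d) (¬∨E₂ d))

  ¬⇒-⊣⊢ : ∀ {A B} → A ∧ᶠ ¬ᶠ B ⊣⊢ ¬ᶠ (A ⇒ᶠ B)
  ¬⇒-⊣⊢ = mk⊣⊢ (λ d → ¬⇒I (∧E₁ d) (∧E₂ d)) (λ d → ∧I (¬⇒E₁ d) (¬⇒E₂ d))

  ⇒-⊣⊢ : ∀ {A B} → ∼ A ∨ᶠ B ⊣⊢ A ⇒ᶠ B
  ⇒-⊣⊢ = mk⊣⊢ (λ d → ∨E d (⇒I (⊥ᶠ-elim (⇒E (weaken¹ hyp₀) hyp₀))) (⇒I (weaken¹ hyp₀)))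
              (λ d → ∨E ⇒CL (∨I₂ (⇒E (weaken¹ d) hyp₀)) (∨I₁ hyp₀))

  ¬¬-⊣⊢ : ∀ {A} → A ⊣⊢ ¬ᶠ ¬ᶠ A
  ¬¬-⊣⊢ = mk⊣⊢ DNI DNE

  ∘¬-⊣⊢ : ∀ {A} → ∘ᶠ A ⊣⊢ ∘ᶠ ¬ᶠ A
  ∘¬-⊣⊢ = mk⊣⊢ I¬∘ E¬∘

  ¬∘-⊣⊢ : ∀ {A} → ∼ ∘ᶠ A ⊣⊢ ¬ᶠ ∘ᶠ A
  ¬∘-⊣⊢ = mk⊣⊢ (λ d → ∨E (PEM∘ I∘) (⊥ᶠ-elim (⇒E (weaken¹ d) hyp₀)) hyp₀)
               (λ d → ⇒I (EXP∘ I∘ hyp₀ (weaken¹ d)))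

  ∘∘-⊣⊢ : ∀ {A} → ⊤ᶠ ⊣⊢ ∘ᶠ ∘ᶠ A
  ∘∘-⊣⊢ = mk⊣⊢ (λ _ → I∘) (λ _ → ⊤ᶠ-intro)

  ∘∧-⊣⊢ : ∀ {A B} → ((((A ∧ᶠ ∘ᶠ A) ∧ᶠ B) ∧ᶠ ∘ᶠ B) ∨ᶠ (¬ᶠ A ∧ᶠ ∘ᶠ A)) ∨ᶠ (¬ᶠ B ∧ᶠ ∘ᶠ B) ⊣⊢ ∘ᶠ (A ∧ᶠ B)
  ∘∧-⊣⊢ = mk⊣⊢
    (λ d → ∨E d (∨E hyp₀ (∧E₁ (I∧T (∧-swap (∧E₁ (∧E₁ hyp₀))) (∧I (∧E₂ hyp₀) (∧E₂ (∧E₁ hyp₀)))))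
                         (∧E₁ (I∧F₁ (∧-swap hyp₀))))
                (∧E₁ (I∧F₂ (∧-swap hyp₀))))
    (λ d → ∨E (PEM∘ d)
      (∨I₁ (∨I₁ (∧I (∧I (∧-swap (E∧T₁ (∧I (weaken¹ d) hyp₀))) (∧E₂ (E∧T₂ (∧I (weaken¹ d) hyp₀))))
                    (∧E₁ (E∧T₂ (∧I (weaken¹ d) hyp₀))))))
      (E∧F (∧I (weaken¹ d) hyp₀) (∨I₁ (∨I₂ (∧-swap hyp₀))) (∨I₂ (∧-swap hyp₀))))

  ∘∨-⊣⊢ : ∀ {A B} → ((((¬ᶠ A ∧ᶠ ∘ᶠ A) ∧ᶠ ¬ᶠ B) ∧ᶠ ∘ᶠ B) ∨ᶠ (A ∧ᶠ ∘ᶠ A)) ∨ᶠ (B ∧ᶠ ∘ᶠ B) ⊣⊢ ∘ᶠ (A ∨ᶠ B)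
  ∘∨-⊣⊢ = mk⊣⊢
    (λ d → ∨E d (∨E hyp₀ (∧E₁ (I∨F (∧-swap (∧E₁ (∧E₁ hyp₀))) (∧I (∧E₂ hyp₀) (∧E₂ (∧E₁ hyp₀)))))
                         (∧E₁ (I∨T₁ (∧-swap hyp₀))))
                (∧E₁ (I∨T₂ (∧-swap hyp₀))))
    (λ d → ∨E (PEM∘ d)
      (E∨T (∧I (weaken¹ d) hyp₀) (∨I₁ (∨I₂ (∧-swap hyp₀))) (∨I₂ (∧-swap hyp₀)))
      (∨I₁ (∨I₁ (∧I (∧I (∧-swap (E∨F₁ (∧I (weaken¹ d) hyp₀))) (∧E₂ (E∨F₂ (∧I (weaken¹ d) hyp₀))))
                    (∧E₁ (E∨F₂ (∧I (weaken¹ d) hyp₀)))))))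

  ∘⇒-⊣⊢ : ∀ {A B} → (((A ∧ᶠ ¬ᶠ B) ∧ᶠ ∘ᶠ B) ∨ᶠ (¬ᶠ A ∧ᶠ ∘ᶠ A)) ∨ᶠ (B ∧ᶠ ∘ᶠ B) ⊣⊢ ∘ᶠ (A ⇒ᶠ B)
  ∘⇒-⊣⊢ = mk⊣⊢
    (λ d → ∨E d (∨E hyp₀ (∧E₁ (I⇒F (∧E₁ (∧E₁ hyp₀)) (∧I (∧E₂ hyp₀) (∧E₂ (∧E₁ hyp₀)))))
                         (∧E₁ (I⇒T₁ (∧-swap hyp₀))))
                (∧E₁ (I⇒T₂ (∧-swap hyp₀))))
    (λ d → ∨E (PEM∘ d)
      (E⇒T (∧I (weaken¹ d) hyp₀) (∨I₁ (∨I₂ (∧-swap hyp₀))) (∨I₂ (∧-swap hyp₀)))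
      (∨I₁ (∨I₁ (∧I (∧I (E⇒F₁ (∧I (weaken¹ d) hyp₀)) (∧E₂ (E⇒F₂ (∧I (weaken¹ d) hyp₀))))
                    (∧E₁ (E⇒F₂ (∧I (weaken¹ d) hyp₀)))))))

  module Canonical (c ℓ : Level) where
    open Twist (lindenbaum c ℓ)

    Represents : Triple → Formula → Set
    Represents z A = (lower (z₁ z) ⊣⊢ A) × (lower (z₂ z) ⊣⊢ ¬ᶠ A) × (lower (z₃ z) ⊣⊢ ∘ᶠ A)

    canonical : Valuation
    canonical n = ⟨ lift (var n) , lift (¬ᶠ var n) , lift (∘ᶠ var n) ⟩
                , lift ∘-excluded , lift ∘-explosive

    ∧̃-represents : ∀ {z w A B} → Represents z A → Represents w B → Represents (z ∧̃ w) (A ∧ᶠ B)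
    ∧̃-represents (a₁ , a₂ , a₃) (b₁ , b₂ , b₃) =
      ∧-cong a₁ b₁ ,
      ⊣⊢-trans (∨-cong a₂ b₂) ¬∧-⊣⊢ ,
      ⊣⊢-trans (∨-cong (∨-cong (∧-cong (∧-cong (∧-cong a₁ a₃) b₁) b₃) (∧-cong a₂ a₃)) (∧-cong b₂ b₃))
                ∘∧-⊣⊢

    ∨̃-represents : ∀ {z w A B} → Represents z A → Represents w B → Represents (z ∨̃ w) (A ∨ᶠ B)
    ∨̃-represents (a₁ , a₂ , a₃) (b₁ , b₂ , b₃) =
      ∨-cong a₁ b₁ ,
      ⊣⊢-trans (∧-cong a₂ b₂) ¬∨-⊣⊢ ,
      ⊣⊢-trans (∨-cong (∨-cong (∧-cong (∧-cong (∧-cong a₂ a₃) b₂) b₃) (∧-cong a₁ a₃)) (∧-cong b₁ b₃))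
                ∘∨-⊣⊢

    ⇒̃-represents : ∀ {z w A B} → Represents z A → Represents w B → Represents (z ⇒̃ w) (A ⇒ᶠ B)
    ⇒̃-represents (a₁ , a₂ , a₃) (b₁ , b₂ , b₃) =
      ⊣⊢-trans (∨-cong (∼-cong a₁) b₁) ⇒-⊣⊢ ,
      ⊣⊢-trans (∧-cong a₁ b₂) ¬⇒-⊣⊢ ,
      ⊣⊢-trans (∨-cong (∨-cong (∧-cong (∧-cong a₁ b₂) b₃) (∧-cong a₂ a₃)) (∧-cong b₁ b₃))
                ∘⇒-⊣⊢

    ¬̃-represents : ∀ {z A} → Represents z A → Represents (¬̃ z) (¬ᶠ A)
    ¬̃-represents (a₁ , a₂ , a₃) = a₂ , ⊣⊢-trans a₁ ¬¬-⊣⊢ , ⊣⊢-trans a₃ ∘¬-⊣⊢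

    ∘̃-represents : ∀ {z A} → Represents z A → Represents (∘̃ z) (∘ᶠ A)
    ∘̃-represents (_ , _ , a₃) = a₃ , ⊣⊢-trans (∼-cong a₃) ¬∘-⊣⊢ , ∘∘-⊣⊢

    truth-lemma : ∀ A → Represents (⟦ A ⟧ canonical) A
    truth-lemma (var n)  = ⊣⊢-refl , ⊣⊢-refl , ⊣⊢-refl
    truth-lemma (A ∧ᶠ B) = ∧̃-represents (truth-lemma A) (truth-lemma B)
    truth-lemma (A ∨ᶠ B) = ∨̃-represents (truth-lemma A) (truth-lemma B)
    truth-lemma (A ⇒ᶠ B) = ⇒̃-represents (truth-lemma A) (truth-lemma B)
    truth-lemma (¬ᶠ A)   = ¬̃-represents (truth-lemma A)
    truth-lemma (∘ᶠ A)   = ∘̃-represents (truth-lemma A)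

    designated⇔derivable : ∀ A → Designated (⟦ A ⟧ canonical) ⇔ (Γ ⊢ A)
    designated⇔derivable A = mk⇔
      (λ A-designated →
        Equivalence.to ⊣⊢⊤ᶠ⇔derivable (⊣⊢-trans (⊣⊢-sym A-represented) (lower A-designated)))
      (λ d → lift (⊣⊢-trans A-represented (Equivalence.from ⊣⊢⊤ᶠ⇔derivable d)))
      where
      A-represented : lower (z₁ (⟦ A ⟧ canonical)) ⊣⊢ A
      A-represented = proj₁ (truth-lemma A)

sound : ∀ {c ℓ Γ A} → Γ ⊢ A → Γ ⊨⟨ c , ℓ ⟩ A
sound d 𝓑 v Γ-designated = ⊤≤⇒≈⊤ (⊩-sound v Γ-designated d [])
  where open BooleanOrder 𝓑
        open Soundness 𝓑

complete : ∀ {c ℓ Γ A} → Γ ⊨⟨ c , ℓ ⟩ A → Γ ⊢ A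
complete {c} {ℓ} {Γ} {A} Γ⊨A =
  Equivalence.to (designated⇔derivable A)
    (Γ⊨A (lindenbaum c ℓ) canonical (λ B ΓB → Equivalence.from (designated⇔derivable B) (prem ΓB)))
  where open Derivations Γ
        open Canonical c ℓ

theorem4p3 : (c ℓ : Level) (Γ : FormulaSet) (A : Formula) → (Γ ⊢ A) ⇔ (Γ ⊨⟨ c , ℓ ⟩ A)
theorem4p3 c ℓ Γ A = mk⇔ sound complete
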